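{- Let $\mathbb{M}$ be one of $\mathsf{K},\mathsf{D},\mathsf{T},\mathsf{K4},\mathsf{S4}$. If $\Pi$ is a proof in the 2-sequent calculus $2_{\mathbb{M}}$ of a 2-sequent $\Gamma\vdash\Delta$, then there exists a cut-free $2_{\mathbb{M}}$-proof $\Pi^*$ of $\Gamma\vdash\Delta$.
   Context: Modal formulas are built from countably many proposition symbols $p_0,p_1,\dots$ using $\neg,\wedge,\vee,\to$ and the unary modal operators $\Box,\Diamond$. Fix a countably infinite set $\mathcal T$ of tokens. A position is a finite (possibly empty) sequence of tokens; $\langle\,\rangle$ is the empty sequence, $\alpha\circ\beta$ is concatenation, and $\alpha\circ x$ abbreviates $\alpha\circ\langle x\rangle$ for a token $x$. Write $\beta\preceq\alpha$ if $\beta$ is a prefix of $\alpha$. A p-formula is an expression $A^{\alpha}$ with $A$ a modal formula and $\alpha$ a position. A 2-sequent is $\Gamma\vdash\Delta$ with $\Gamma,\Delta$ finite (possibly empty) sequences of p-formulas. For a sequence $\Gamma$ of p-formulas, $I(\Gamma)=\{\beta:\exists A^{\alpha}\in\Gamma,\ \beta\preceq\alpha\}$. The calculus $2_{\mathsf{S4}}$ has the rules (all sequences may be empty): Axiom $A^\alpha\vdash A^\alpha$; Cut: from $\Gamma_1\vdash A^\alpha,\Delta_1$ and $\Gamma_2,A^\alpha\vdash\Delta_2$ infer $\Gamma_1,\Gamma_2\vdash\Delta_1,\Delta_2$; weakening, contraction and exchange on both sides; propositional rules, in which all active p-formulas carry the same position $\alpha$: from $\Gamma\vdash A^\alpha,\Delta$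 infer $\Gamma,(\neg A)^\alpha\vdash\Delta$; from $\Gamma,A^\alpha\vdash\Delta$ infer $\Gamma\vdash(\neg A)^\alpha,\Delta$; from $\Gamma,A^\alpha\vdash\Delta$ (or $\Gamma,B^\alpha\vdash\Delta$) infer $\Gamma,(A\wedge B)^\alpha\vdash\Delta$; from $\Gamma_1\vdash A^\alpha,\Delta_1$ and $\Gamma_2\vdash B^\alpha,\Delta_2$ infer $\Gamma_1,\Gamma_2\vdash(A\wedge B)^\alpha,\Delta_1,\Delta_2$; from $\Gamma_1,A^\alpha\vdash\Delta_1$ and $\Gamma_2,B^\alpha\vdash\Delta_2$ infer $\Gamma_1,\Gamma_2,(A\vee B)^\alpha\vdash\Delta_1,\Delta_2$; from $\Gamma\vdash A^\alpha,\Delta$ (or $\Gamma\vdash B^\alpha,\Delta$) infer $\Gamma\vdash(A\vee B)^\alpha,\Delta$; from $\Gamma_1,B^\alpha\vdash\Delta_1$ and $\Gamma_2\vdash A^\alpha,\Delta_2$ infer $\Gamma_1,\Gamma_2,(A\to B)^\alpha\vdash\Delta_1,\Delta_2$; from $\Gamma,A^\alpha\vdash B^\alpha,\Delta$ infer $\Gamma\vdash(A\to B)^\alpha,\Delta$. Modal rules: ($\Box\vdash$) from $\Gamma,A^{\alpha\circ\beta}\vdash\Delta$ infer $\Gamma,(\Box A)^\alpha\vdash\Delta$; ($\vdash\Box$) from $\Gamma\vdash A^{\alpha\circ x},\Delta$ infer $\Gamma\vdash(\Box A)^\alpha,\Delta$; ($\Diamond\vdash$) from $\Gamma,A^{\alpha\circ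 x}\vdash\Delta$ infer $\Gamma,(\Diamond A)^\alpha\vdash\Delta$; ($\vdash\Diamond$) from $\Gamma\vdash A^{\alpha\circ\beta},\Delta$ infer $\Gamma\vdash(\Diamond A)^\alpha,\Delta$; here $\beta$ is a position, $x$ a token, and in $\vdash\Box$ and $\Diamond\vdash$ it is required that $\alpha\circ x\notin I(\Gamma,\Delta)$. The calculi $2_{\mathsf T},2_{\mathsf D},2_{\mathsf{K4}},2_{\mathsf K}$ have the same rules with extra constraints on $\Box\vdash$ and $\vdash\Diamond$: in $2_{\mathsf T}$, $\beta$ is empty or a single token; in $2_{\mathsf D}$, $\beta$ is a single token; in $2_{\mathsf{K4}}$, $\beta$ is nonempty and $\Gamma$ or $\Delta$ contains a p-formula $B^{\alpha\circ\beta\circ\eta}$ for some formula $B$ and position $\eta$; in $2_{\mathsf K}$, $\beta$ is a single token and $\Gamma$ or $\Delta$ contains a p-formula $B^{\alpha\circ\beta\circ\eta}$. Moreover in $2_{\mathsf K}$ and $2_{\mathsf{K4}}$ the Cut rule may only be applied when $\alpha\in I(\Gamma_1,\Delta_1)$ or $\alpha\in I(\Gamma_2,\Delta_2)$. A proof is cut-free if it contains no application of Cut. -}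

module Defs where

open import Data.Nat using (ℕ)
open import Data.List using (List; []; _∷_; _++_; [_])
open import Data.List.Relation.Unary.Any using (Any)
open import Data.List.Membership.Propositional using (_∈_)
open import Data.Product using (Σ; ∃; _×_; _,_)
open import Data.Sum using (_⊎_)
open import Data.Unit using (⊤)
open import Data.Empty using (⊥)
open import Relation.Nullary using (¬_)
open import Relation.Binary.PropositionalEquality using (_≡_; _≢_)

data Fm : Set where
  var  : ℕ → Fm
  ~_   : Fm → Fm
  _∧_  : Fm → Fm → Fm
  _∨_  : Fm → Fm → Fm
  _⇒_  : Fm → Fm → Fm
  □_   : Fm → Fm
  ◇_   : Fm → Fm

Token : Set
Token = ℕ

-- Positions: finite sequences of tokens; α ∘ β is α ++ β.
Pos : Set
Pos = List Token

record PFm : Set where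
  constructor _^_
  field
    fm  : Fm
    pos : Pos
open PFm public

Seq : Set
Seq = List PFm

_⪯_ : Pos → Pos → Set
β ⪯ α = Σ Pos λ γ → β ++ γ ≡ α

InI : Pos → Seq → Set
InI β Γ = Any (λ p → β ⪯ pos p) Γ

data Logic : Set where
  K D T K4 S4 : Logic

ModCond : Logic → Pos → Pos → Seq → Seq → Set
ModCond S4 α β Γ Δ = ⊤
ModCond T  α β Γ Δ = (β ≡ []) ⊎ (Σ Token λ x → β ≡ [ x ])
ModCond D  α β Γ Δ = Σ Token λ x → β ≡ [ x ]
ModCond K4 α β Γ Δ =
  (β ≢ []) × (Σ Fm λ B → Σ Pos λ η → (B ^ (α ++ β ++ η)) ∈ (Γ ++ Δ))
ModCond K  α β Γ Δ =
  (Σ Token λ x → β ≡ [ x ]) × (Σ Fm λ B → Σ Pos λ η → (B ^ (α ++ β ++ η)) ∈ (Γ ++ Δ))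

CutCond : Logic → Pos → Seq → Seq → Seq → Seq → Set
CutCond K  α Γ₁ Δ₁ Γ₂ Δ₂ = InI α (Γ₁ ++ Δ₁) ⊎ InI α (Γ₂ ++ Δ₂)
CutCond K4 α Γ₁ Δ₁ Γ₂ Δ₂ = InI α (Γ₁ ++ Δ₁) ⊎ InI α (Γ₂ ++ Δ₂)
CutCond D  α Γ₁ Δ₁ Γ₂ Δ₂ = ⊤
CutCond T  α Γ₁ Δ₁ Γ₂ Δ₂ = ⊤
CutCond S4 α Γ₁ Δ₁ Γ₂ Δ₂ = ⊤

data Proof (M : Logic) : Seq → Seq → Set where
  ax   : ∀ {A} → Proof M [ A ] [ A ]
  cut  : ∀ {Γ₁ Δ₁ Γ₂ Δ₂ A α} → CutCond M α Γ₁ Δ₁ Γ₂ Δ₂ →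
         Proof M Γ₁ ((A ^ α) ∷ Δ₁) → Proof M (Γ₂ ++ [ A ^ α ]) Δ₂ →
         Proof M (Γ₁ ++ Γ₂) (Δ₁ ++ Δ₂)
  wL   : ∀ {Γ Δ P} → Proof M Γ Δ → Proof M (Γ ++ [ P ]) Δ
  wR   : ∀ {Γ Δ P} → Proof M Γ Δ → Proof M Γ (P ∷ Δ)
  cL   : ∀ {Γ Δ P} → Proof M (Γ ++ P ∷ P ∷ []) Δ → Proof M (Γ ++ [ P ]) Δ
  cR   : ∀ {Γ Δ P} → Proof M Γ (P ∷ P ∷ Δ) → Proof M Γ (P ∷ Δ)
  eL   : ∀ {Γ₁ Γ₂ Δ P Q} → Proof M (Γ₁ ++ P ∷ Q ∷ Γ₂) Δ → Proof M (Γ₁ ++ Q ∷ P ∷ Γ₂) Δ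
  eR   : ∀ {Γ Δ₁ Δ₂ P Q} → Proof M Γ (Δ₁ ++ P ∷ Q ∷ Δ₂) → Proof M Γ (Δ₁ ++ Q ∷ P ∷ Δ₂)
  ¬L   : ∀ {Γ Δ A α} → Proof M Γ ((A ^ α) ∷ Δ) → Proof M (Γ ++ [ (~ A) ^ α ]) Δ
  ¬R   : ∀ {Γ Δ A α} → Proof M (Γ ++ [ A ^ α ]) Δ → Proof M Γ (((~ A) ^ α) ∷ Δ)
  ∧L₁  : ∀ {Γ Δ A B α} → Proof M (Γ ++ [ A ^ α ]) Δ → Proof M (Γ ++ [ (A ∧ B) ^ α ]) Δ
  ∧L₂  : ∀ {Γ Δ A B α} → Proof M (Γ ++ [ B ^ α ]) Δ → Proof M (Γ ++ [ (A ∧ B) ^ α ]) Δ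
  ∧R   : ∀ {Γ₁ Γ₂ Δ₁ Δ₂ A B α} → Proof M Γ₁ ((A ^ α) ∷ Δ₁) → Proof M Γ₂ ((B ^ α) ∷ Δ₂) →
         Proof M (Γ₁ ++ Γ₂) (((A ∧ B) ^ α) ∷ (Δ₁ ++ Δ₂))
  ∨L   : ∀ {Γ₁ Γ₂ Δ₁ Δ₂ A B α} → Proof M (Γ₁ ++ [ A ^ α ]) Δ₁ → Proof M (Γ₂ ++ [ B ^ α ]) Δ₂ →
         Proof M ((Γ₁ ++ Γ₂) ++ [ (A ∨ B) ^ α ]) (Δ₁ ++ Δ₂)
  ∨R₁  : ∀ {Γ Δ A B α} → Proof M Γ ((A ^ α) ∷ Δ) → Proof M Γ (((A ∨ B) ^ α) ∷ Δ)
  ∨R₂  : ∀ {Γ Δ A B α} → Proof M Γ ((B ^ α) ∷ Δ) → Proof M Γ (((A ∨ B) ^ α) ∷ Δ)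
  ⇒L   : ∀ {Γ₁ Γ₂ Δ₁ Δ₂ A B α} → Proof M (Γ₁ ++ [ B ^ α ]) Δ₁ → Proof M Γ₂ ((A ^ α) ∷ Δ₂) →
         Proof M ((Γ₁ ++ Γ₂) ++ [ (A ⇒ B) ^ α ]) (Δ₁ ++ Δ₂)
  ⇒R   : ∀ {Γ Δ A B α} → Proof M (Γ ++ [ A ^ α ]) ((B ^ α) ∷ Δ) → Proof M Γ (((A ⇒ B) ^ α) ∷ Δ)
  □L   : ∀ {Γ Δ A α β} → ModCond M α β Γ Δ →
         Proof M (Γ ++ [ A ^ (α ++ β) ]) Δ → Proof M (Γ ++ [ (□ A) ^ α ]) Δ
  □R   : ∀ {Γ Δ A α x} → ¬ InI (α ++ [ x ]) (Γ ++ Δ) →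
         Proof M Γ ((A ^ (α ++ [ x ])) ∷ Δ) → Proof M Γ (((□ A) ^ α) ∷ Δ)
  ◇L   : ∀ {Γ Δ A α x} → ¬ InI (α ++ [ x ]) (Γ ++ Δ) →
         Proof M (Γ ++ [ A ^ (α ++ [ x ]) ]) Δ → Proof M (Γ ++ [ (◇ A) ^ α ]) Δ
  ◇R   : ∀ {Γ Δ A α β} → ModCond M α β Γ Δ →
         Proof M Γ ((A ^ (α ++ β)) ∷ Δ) → Proof M Γ (((◇ A) ^ α) ∷ Δ)

CutFree : ∀ {M Γ Δ} → Proof M Γ Δ → Set
CutFree ax = ⊤
CutFree (cut _ _ _) = ⊥
CutFree (wL p) = CutFree p
CutFree (wR p) = CutFree p
CutFree (cL p) = CutFree p
CutFree (cR p) = CutFree p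
CutFree (eL p) = CutFree p
CutFree (eR p) = CutFree p
CutFree (¬L p) = CutFree p
CutFree (¬R p) = CutFree p
CutFree (∧L₁ p) = CutFree p
CutFree (∧L₂ p) = CutFree p
CutFree (∧R p q) = CutFree p × CutFree q
CutFree (∨L p q) = CutFree p × CutFree q
CutFree (∨R₁ p) = CutFree p
CutFree (∨R₂ p) = CutFree p
CutFree (⇒L p q) = CutFree p × CutFree q
CutFree (⇒R p) = CutFree p
CutFree (□L _ p) = CutFree p
CutFree (□R _ p) = CutFree p
CutFree (◇L _ p) = CutFree p
CutFree (◇R _ p) = CutFree p

module Submission where

-- Instead of permuting cuts upwards inside 2_M we pass through an auxiliary
-- calculus Der M in which sequents are read as sets: every logical rule keeps
-- its principal p-formula and may take it from anywhere in the context, so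
-- weakening, contraction and exchange are built in, and the eigentoken rules
-- (⊢□), (◇⊢) have one premise for every fresh token.
--   1. A position substitution replaces every token of a position by a whole
--      position of the shape allowed by M.  Der M is closed under such
--      substitutions into larger contexts (derSubst); weakening is the case of
--      the identity substitution (derWeaken).
--   2. Cut is admissible in Der M (cutAdmissible).  By induction on the cut
--      formula, and inside that on the two derivations, the cut formula is
--      traced up each derivation until it is principal; there the cut reduces
--      to cuts on immediate subformulas (principalCut), the modal cases
--      instantiating the eigentoken through a substitution from step 1.
--   3. Every 2_M proof translates into Der M, Cut going through step 2
--      (proofToDer), and every Der M derivation translates back into a
--      cut-free 2_M proof by means of the structural rules (derToCutFree).

open import Defs
open import Data.Nat using (ℕ; suc; _+_; _≤_)
open import Data.Nat.Properties using (≤-trans; m≤m+n; m≤n+m; n≮n; ≤-refl; _≟_)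
open import Data.Nat.ListAction using (sum)
open import Data.List using (List; []; _∷_; _++_; [_])
open import Data.List.Properties using (++-assoc; ++-identityʳ; ++-identityʳ-unique; ≡-dec)
open import Data.List.Relation.Unary.Any as Any using (Any; here; there)
open import Data.List.Membership.Propositional using (_∈_; lose; find)
open import Data.List.Membership.Propositional.Properties using (∈-++⁺ˡ; ∈-++⁺ʳ; ∈-++⁻; ∈-∃++)
open import Data.List.Relation.Binary.Subset.Propositional using (_⊆_)
open import Data.List.Relation.Binary.Subset.Propositional.Properties
  using (⊆-refl; ⊆-trans; ⊆-reflexive-↭; xs⊆x∷xs; ∷⁺ʳ; ∈-∷⁺ʳ; xs⊆xs++ys; xs⊆ys++xs; ++⁺; ++⁺ʳ; Any-resp-⊆)
open import Data.List.Relation.Binary.Permutation.Propositional as ↭ using (_↭_)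
open import Data.List.Relation.Binary.Permutation.Propositional.Properties using (shift; ++-comm)
open import Data.Product using (Σ; _×_; _,_)
open import Data.Sum using (_⊎_; inj₁; inj₂)
open import Data.Unit using (⊤; tt)
open import Data.Empty using (⊥; ⊥-elim)
open import Relation.Nullary using (¬_; yes; no)
open import Relation.Binary.PropositionalEquality using (_≡_; _≢_; refl; sym; trans; cong; cong₂; subst; module ≡-Reasoning)

∈⇒InI : ∀ {P Ξ} → P ∈ Ξ → InI (pos P) Ξ
∈⇒InI {P} m = lose m ([] , ++-identityʳ (pos P))

InI-prefix : ∀ {β γ Ξ} → β ⪯ γ → InI γ Ξ → InI β Ξ
InI-prefix {β} (δ , refl) = Any.map λ { (ε , eq) → δ ++ ε , trans (sym (++-assoc β δ ε)) eq }

∉I-++ˡ : ∀ {π} Γ Δ → ¬ InI π (Γ ++ Δ) → ¬ InI π Γ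
∉I-++ˡ Γ Δ n i = n (Any-resp-⊆ (xs⊆xs++ys Γ Δ) i)

∉I-++ʳ : ∀ {π} Γ Δ → ¬ InI π (Γ ++ Δ) → ¬ InI π Δ
∉I-++ʳ Γ Δ n i = n (Any-resp-⊆ (xs⊆ys++xs Δ Γ) i)

occurs⇒InI : ∀ {α β Ξ} → (Σ Fm λ B → Σ Pos λ η → (B ^ (α ++ β ++ η)) ∈ Ξ) → InI (α ++ β) Ξ
occurs⇒InI {α} {β} (B , η , m) = lose m (η , ++-assoc α β η)

InI⇒occurs : ∀ {α β Ξ} → InI (α ++ β) Ξ → Σ Fm λ B → Σ Pos λ η → (B ^ (α ++ β ++ η)) ∈ Ξ
InI⇒occurs {α} {β} {Ξ} i with find i
... | Q , m , (η , eq) =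
  fm Q , η , subst (λ π → (fm Q ^ π) ∈ Ξ) (trans (sym eq) (++-assoc α β η)) m

++-⊆ : ∀ {X Y Z : Seq} → X ⊆ Z → Y ⊆ Z → (X ++ Y) ⊆ Z
++-⊆ {X} s t m with ∈-++⁻ X m
... | inj₁ m₁ = s m₁
... | inj₂ m₂ = t m₂

++-idem : ∀ {X : Seq} → (X ++ X) ⊆ X
++-idem = ++-⊆ ⊆-refl ⊆-refl

snoc⊆ : ∀ {P} {X : Seq} → P ∈ X → (X ++ [ P ]) ⊆ X
snoc⊆ m = ++-⊆ ⊆-refl (∈-∷⁺ʳ m (λ ()))

∷⊆snoc : ∀ {P} {X : Seq} → (P ∷ X) ⊆ (X ++ [ P ])
∷⊆snoc {X = X} = ∈-∷⁺ʳ (∈-++⁺ʳ X (here refl)) (xs⊆xs++ys X _)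

snoc⊆∷ : ∀ {P} {X Y : Seq} → X ⊆ Y → (X ++ [ P ]) ⊆ (P ∷ Y)
snoc⊆∷ s = ++-⊆ (⊆-trans s (xs⊆x∷xs _ _)) (∈-∷⁺ʳ (here refl) (λ ()))

swap⊆ : ∀ {P Q} {X : Seq} → (P ∷ Q ∷ X) ⊆ (Q ∷ P ∷ X)
swap⊆ = ⊆-reflexive-↭ (↭.swap _ _ ↭.refl)

-- The positions β admitted as the step of (□⊢) and (⊢◇) in 2_M.
Shape : Logic → Pos → Set
Shape S4 β = ⊤
Shape T  β = (β ≡ []) ⊎ (Σ Token λ x → β ≡ [ x ])
Shape D  β = Σ Token λ x → β ≡ [ x ]
Shape K  β = Σ Token λ x → β ≡ [ x ]
Shape K4 β = β ≢ []

single : ∀ M x → Shape M [ x ]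
single K  x = x , refl
single D  x = x , refl
single T  x = inj₂ (x , refl)
single K4 x = λ ()
single S4 x = tt

-- The logics whose (□⊢), (⊢◇) and Cut only use positions of the sequent.
Restricted : Logic → Set
Restricted K  = ⊤
Restricted K4 = ⊤
Restricted _  = ⊥

record Present (M : Logic) (π : Pos) (Γ Δ : Seq) : Set where
  constructor present
  field inI : Restricted M → InI π (Γ ++ Δ)
open Present

present-mono : ∀ {M π Γ Δ Γ′ Δ′} → Γ ⊆ Γ′ → Δ ⊆ Δ′ → Present M π Γ Δ → Present M π Γ′ Δ′
present-mono s t p = present λ r → Any-resp-⊆ (++⁺ s t) (inI p r)

-- The side condition of (□⊢) and (⊢◇) is a shape condition plus presence of α∘β.
modCond⇒shape : ∀ M {α β Γ Δ} → ModCond M α β Γ Δ → Shape M β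
modCond⇒shape K  (s , _) = s
modCond⇒shape K4 (s , _) = s
modCond⇒shape D  s = s
modCond⇒shape T  s = s
modCond⇒shape S4 s = s

modCond⇒present : ∀ M {α β Γ Δ} → ModCond M α β Γ Δ → Present M (α ++ β) Γ Δ
modCond⇒present K  {α} {β} (_ , o) = present λ _ → occurs⇒InI {α} {β} o
modCond⇒present K4 {α} {β} (_ , o) = present λ _ → occurs⇒InI {α} {β} o
modCond⇒present D  _ = present λ ()
modCond⇒present T  _ = present λ ()
modCond⇒present S4 _ = present λ ()

modCond-intro : ∀ M {α β Γ Δ} → Shape M β → Present M (α ++ β) Γ Δ → ModCond M α β Γ Δ
modCond-intro K  {α} {β} s p = s , InI⇒occurs {α} {β} (inI p tt)
modCond-intro K4 {α} {β} s p = s , InI⇒occurs {α} {β} (inI p tt)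
modCond-intro D  s _ = s
modCond-intro T  s _ = s
modCond-intro S4 s _ = s

modCond-mono : ∀ M {α β Γ Δ Γ′ Δ′} → Γ ⊆ Γ′ → Δ ⊆ Δ′ → ModCond M α β Γ Δ → ModCond M α β Γ′ Δ′
modCond-mono M s t c = modCond-intro M (modCond⇒shape M c) (present-mono s t (modCond⇒present M c))

InI-cut : ∀ {α} Γ₁ Δ₁ Γ₂ Δ₂ → InI α (Γ₁ ++ Δ₁) ⊎ InI α (Γ₂ ++ Δ₂) → InI α ((Γ₁ ++ Γ₂) ++ (Δ₁ ++ Δ₂))
InI-cut Γ₁ Δ₁ Γ₂ Δ₂ (inj₁ i) = Any-resp-⊆ (++⁺ (xs⊆xs++ys Γ₁ Γ₂) (xs⊆xs++ys Δ₁ Δ₂)) i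
InI-cut Γ₁ Δ₁ Γ₂ Δ₂ (inj₂ i) = Any-resp-⊆ (++⁺ (xs⊆ys++xs Γ₂ Γ₁) (xs⊆ys++xs Δ₂ Δ₁)) i

cutCond⇒present : ∀ M {α Γ₁ Δ₁ Γ₂ Δ₂} → CutCond M α Γ₁ Δ₁ Γ₂ Δ₂ → Present M α (Γ₁ ++ Γ₂) (Δ₁ ++ Δ₂)
cutCond⇒present K  {_} {Γ₁} {Δ₁} {Γ₂} {Δ₂} c = present λ _ → InI-cut Γ₁ Δ₁ Γ₂ Δ₂ c
cutCond⇒present K4 {_} {Γ₁} {Δ₁} {Γ₂} {Δ₂} c = present λ _ → InI-cut Γ₁ Δ₁ Γ₂ Δ₂ c
cutCond⇒present D  _ = present λ ()
cutCond⇒present T  _ = present λ ()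
cutCond⇒present S4 _ = present λ ()

-- Position substitutions

-- A position substitution sends the token y, occurring right after the
-- prefix γ, to the position h γ y.
PosSubst : Set
PosSubst = Pos → Token → Pos

substAfter : PosSubst → Pos → Pos → Pos
substAfter h γ [] = []
substAfter h γ (y ∷ δ) = h γ y ++ substAfter h (γ ++ [ y ]) δ

substPos : PosSubst → Pos → Pos
substPos h π = substAfter h [] π

substPFm : PosSubst → PFm → PFm
substPFm h P = fm P ^ substPos h (pos P)

substAfter-++ : ∀ h γ δ ε → substAfter h γ (δ ++ ε) ≡ substAfter h γ δ ++ substAfter h (γ ++ δ) ε
substAfter-++ h γ [] ε = cong (λ γ′ → substAfter h γ′ ε) (sym (++-identityʳ γ))
substAfter-++ h γ (y ∷ δ) ε = begin
  h γ y ++ substAfter h (γ ++ [ y ]) (δ ++ ε)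
    ≡⟨ cong (h γ y ++_) (substAfter-++ h (γ ++ [ y ]) δ ε) ⟩
  h γ y ++ (substAfter h (γ ++ [ y ]) δ ++ substAfter h ((γ ++ [ y ]) ++ δ) ε)
    ≡⟨ sym (++-assoc (h γ y) _ _) ⟩
  (h γ y ++ substAfter h (γ ++ [ y ]) δ) ++ substAfter h ((γ ++ [ y ]) ++ δ) ε
    ≡⟨ cong (λ γ′ → (h γ y ++ substAfter h (γ ++ [ y ]) δ) ++ substAfter h γ′ ε) (++-assoc γ [ y ] δ) ⟩
  (h γ y ++ substAfter h (γ ++ [ y ]) δ) ++ substAfter h (γ ++ y ∷ δ) ε ∎
  where open ≡-Reasoning

substPos-++ : ∀ h α β → substPos h (α ++ β) ≡ substPos h α ++ substAfter h α β
substPos-++ h α β = substAfter-++ h [] α β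

substPFm-++ : ∀ h α β A → substPFm h (A ^ (α ++ β)) ≡ A ^ (substPos h α ++ substAfter h α β)
substPFm-++ h α β A = cong (A ^_) (substPos-++ h α β)

substPos-mono : ∀ h {β γ} → β ⪯ γ → substPos h β ⪯ substPos h γ
substPos-mono h {β} (δ , refl) = substAfter h β δ , sym (substPos-++ h β δ)

Admissible : Logic → PosSubst → Set
Admissible M h = ∀ γ y → Shape M (h γ y)

substAfter-single : ∀ h α x → substAfter h α [ x ] ≡ h α x
substAfter-single h α x = ++-identityʳ (h α x)

substAfter-shape : ∀ M {h} α β → Admissible M h → Shape M β → Shape M (substAfter h α β)
substAfter-shape S4 α β adm s = tt
substAfter-shape T  α β adm (inj₁ refl) = inj₁ refl
substAfter-shape T  {h} α β adm (inj₂ (x , refl)) = subst (Shape T) (sym (substAfter-single h α x)) (adm α x)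
substAfter-shape D  {h} α β adm (x , refl) = subst (Shape D) (sym (substAfter-single h α x)) (adm α x)
substAfter-shape K  {h} α β adm (x , refl) = subst (Shape K) (sym (substAfter-single h α x)) (adm α x)
substAfter-shape K4 α [] adm s = ⊥-elim (s refl)
substAfter-shape K4 {h} α (y ∷ β) adm s = ++-nonempty (adm α y)
  where
    ++-nonempty : ∀ {xs ys : Pos} → xs ≢ [] → xs ++ ys ≢ []
    ++-nonempty {[]}    ne _ = ne refl
    ++-nonempty {_ ∷ _} ne ()

-- update h α y z sends the token y after α to z and agrees with h elsewhere;
-- it instantiates the eigentoken y of a (⊢□) or (◇⊢) step by z.
update : PosSubst → Pos → Token → Pos → PosSubst
update h α y z γ w with ≡-dec _≟_ γ α | w ≟ y
... | yes _ | yes _ = z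
... | _     | _     = h γ w

update-at : ∀ h α y z → update h α y z α y ≡ z
update-at h α y z with ≡-dec _≟_ α α | y ≟ y
... | yes _ | yes _ = refl
... | no α≢α | _     = ⊥-elim (α≢α refl)
... | yes _ | no y≢y = ⊥-elim (y≢y refl)

update-elsewhere : ∀ h α y z γ w → ¬ (γ ≡ α × w ≡ y) → update h α y z γ w ≡ h γ w
update-elsewhere h α y z γ w ne with ≡-dec _≟_ γ α | w ≟ y
... | yes p | yes q = ⊥-elim (ne (p , q))
... | yes _ | no _  = refl
... | no _  | yes _ = refl
... | no _  | no _  = refl

update-admissible : ∀ M {h} α y z → Shape M z → Admissible M h → Admissible M (update h α y z)
update-admissible M {h} α y z sz adm γ w with ≡-dec _≟_ γ α | w ≟ y
... | yes _ | yes _ = sz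
... | yes _ | no _  = adm γ w
... | no _  | yes _ = adm γ w
... | no _  | no _  = adm γ w

substAfter-update : ∀ h α y z γ δ → ¬ ((α ++ [ y ]) ⪯ (γ ++ δ)) →
                    substAfter (update h α y z) γ δ ≡ substAfter h γ δ
substAfter-update h α y z γ [] _ = refl
substAfter-update h α y z γ (w ∷ δ) n =
  cong₂ _++_ (update-elsewhere h α y z γ w notHere)
             (substAfter-update h α y z (γ ++ [ w ]) δ notLater)
  where
    notHere : ¬ (γ ≡ α × w ≡ y)
    notHere (refl , refl) = n (δ , ++-assoc γ [ w ] δ)
    notLater : ¬ ((α ++ [ y ]) ⪯ ((γ ++ [ w ]) ++ δ))
    notLater (ζ , eq) = n (ζ , trans eq (++-assoc γ [ w ] δ))

substPos-update : ∀ h α y z π → ¬ ((α ++ [ y ]) ⪯ π) → substPos (update h α y z) π ≡ substPos h π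
substPos-update h α y z π n = substAfter-update h α y z [] π n

¬self-extension : ∀ (α : Pos) y γ → α ++ y ∷ γ ≢ α
¬self-extension α y γ eq with ++-identityʳ-unique α (sym eq)
... | ()

substPos-update-at : ∀ h α y z → substPos (update h α y z) (α ++ [ y ]) ≡ substPos h α ++ z
substPos-update-at h α y z = begin
  substPos (update h α y z) (α ++ [ y ])
    ≡⟨ substPos-++ (update h α y z) α [ y ] ⟩
  substPos (update h α y z) α ++ substAfter (update h α y z) α [ y ]
    ≡⟨ cong₂ _++_ (substPos-update h α y z α α∘y⋠α) (substAfter-single (update h α y z) α y) ⟩
  substPos h α ++ update h α y z α y
    ≡⟨ cong (substPos h α ++_) (update-at h α y z) ⟩
  substPos h α ++ z ∎
  where
    open ≡-Reasoning
    α∘y⋠α : ¬ ((α ++ [ y ]) ⪯ α)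
    α∘y⋠α (ζ , eq) = ¬self-extension α y ζ (trans (sym (++-assoc α [ y ] ζ)) eq)

substPFm-update-at : ∀ h α y z A → substPFm (update h α y z) (A ^ (α ++ [ y ])) ≡ A ^ (substPos h α ++ z)
substPFm-update-at h α y z A = cong (A ^_) (substPos-update-at h α y z)

idSubst : PosSubst
idSubst γ y = [ y ]

substAfter-id : ∀ γ δ → substAfter idSubst γ δ ≡ δ
substAfter-id γ [] = refl
substAfter-id γ (y ∷ δ) = cong (y ∷_) (substAfter-id (γ ++ [ y ]) δ)

substPFm-id : ∀ P → substPFm idSubst P ≡ P
substPFm-id P = cong (fm P ^_) (substAfter-id [] (pos P))

idSubst-admissible : ∀ M → Admissible M idSubst
idSubst-admissible M γ y = single M y

rename-eigentoken : ∀ α x z A → substPFm (update idSubst α x z) (A ^ (α ++ [ x ])) ≡ A ^ (α ++ z)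
rename-eigentoken α x z A =
  trans (substPFm-update-at idSubst α x z A) (cong (λ π → A ^ (π ++ z)) (substAfter-id [] α))

tokenSum : Seq → ℕ
tokenSum [] = 0
tokenSum (P ∷ Ξ) = sum (pos P) + tokenSum Ξ

∈⇒≤sum : ∀ {x : ℕ} {xs} → x ∈ xs → x ≤ sum xs
∈⇒≤sum {xs = x ∷ xs} (here refl) = m≤m+n x (sum xs)
∈⇒≤sum {xs = y ∷ xs} (there m) = ≤-trans (∈⇒≤sum m) (m≤n+m (sum xs) y)

fresh : Seq → Token
fresh Ξ = suc (tokenSum Ξ)

∉I-above-sum : ∀ α n Ξ → tokenSum Ξ ≤ n → ¬ InI (α ++ [ suc n ]) Ξ
∉I-above-sum α n (P ∷ Ξ) b (here (γ , eq)) =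
  n≮n n (≤-trans (∈⇒≤sum n+1∈P) (≤-trans (m≤m+n _ (tokenSum Ξ)) b))
  where
    n+1∈P : suc n ∈ pos P
    n+1∈P = subst (suc n ∈_) eq (∈-++⁺ˡ (∈-++⁺ʳ α (here refl)))
∉I-above-sum α n (P ∷ Ξ) b (there i) =
  ∉I-above-sum α n Ξ (≤-trans (m≤n+m (tokenSum Ξ) (sum (pos P))) b) i

fresh-∉I : ∀ α Ξ → ¬ InI (α ++ [ fresh Ξ ]) Ξ
fresh-∉I α Ξ = ∉I-above-sum α (tokenSum Ξ) Ξ ≤-refl

module Calculus (M : Logic) where

  data Der : Seq → Seq → Set where
    ax  : ∀ {Γ Δ P} → P ∈ Γ → P ∈ Δ → Der Γ Δ
    ¬L  : ∀ {Γ Δ A α} → ((~ A) ^ α) ∈ Γ → Der Γ ((A ^ α) ∷ Δ) → Der Γ Δ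
    ¬R  : ∀ {Γ Δ A α} → ((~ A) ^ α) ∈ Δ → Der ((A ^ α) ∷ Γ) Δ → Der Γ Δ
    ∧L₁ : ∀ {Γ Δ A B α} → ((A ∧ B) ^ α) ∈ Γ → Der ((A ^ α) ∷ Γ) Δ → Der Γ Δ
    ∧L₂ : ∀ {Γ Δ A B α} → ((A ∧ B) ^ α) ∈ Γ → Der ((B ^ α) ∷ Γ) Δ → Der Γ Δ
    ∧R  : ∀ {Γ Δ A B α} → ((A ∧ B) ^ α) ∈ Δ → Der Γ ((A ^ α) ∷ Δ) → Der Γ ((B ^ α) ∷ Δ) → Der Γ Δ
    ∨L  : ∀ {Γ Δ A B α} → ((A ∨ B) ^ α) ∈ Γ → Der ((A ^ α) ∷ Γ) Δ → Der ((B ^ α) ∷ Γ) Δ → Der Γ Δ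
    ∨R₁ : ∀ {Γ Δ A B α} → ((A ∨ B) ^ α) ∈ Δ → Der Γ ((A ^ α) ∷ Δ) → Der Γ Δ
    ∨R₂ : ∀ {Γ Δ A B α} → ((A ∨ B) ^ α) ∈ Δ → Der Γ ((B ^ α) ∷ Δ) → Der Γ Δ
    ⇒L  : ∀ {Γ Δ A B α} → ((A ⇒ B) ^ α) ∈ Γ → Der ((B ^ α) ∷ Γ) Δ → Der Γ ((A ^ α) ∷ Δ) → Der Γ Δ
    ⇒R  : ∀ {Γ Δ A B α} → ((A ⇒ B) ^ α) ∈ Δ → Der ((A ^ α) ∷ Γ) ((B ^ α) ∷ Δ) → Der Γ Δ
    □L  : ∀ {Γ Δ A α β} → ((□ A) ^ α) ∈ Γ → ModCond M α β Γ Δ → Der ((A ^ (α ++ β)) ∷ Γ) Δ → Der Γ Δ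
    □R  : ∀ {Γ Δ A α} → ((□ A) ^ α) ∈ Δ →
          (∀ x → ¬ InI (α ++ [ x ]) (Γ ++ Δ) → Der Γ ((A ^ (α ++ [ x ])) ∷ Δ)) → Der Γ Δ
    ◇L  : ∀ {Γ Δ A α} → ((◇ A) ^ α) ∈ Γ →
          (∀ x → ¬ InI (α ++ [ x ]) (Γ ++ Δ) → Der ((A ^ (α ++ [ x ])) ∷ Γ) Δ) → Der Γ Δ
    ◇R  : ∀ {Γ Δ A α β} → ((◇ A) ^ α) ∈ Δ → ModCond M α β Γ Δ → Der Γ ((A ^ (α ++ β)) ∷ Δ) → Der Γ Δ

  Maps : PosSubst → Seq → Seq → Set
  Maps h X Y = ∀ {P} → P ∈ X → substPFm h P ∈ Y

  maps-∷ : ∀ {h P Q X Y} → substPFm h P ≡ Q → Maps h X Y → Maps h (P ∷ X) (Q ∷ Y)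
  maps-∷ refl s (here refl) = here refl
  maps-∷ refl s (there m)   = there (s m)

  maps-∷⁺ : ∀ {h P Q C X Y} → substPFm h P ≡ Q → Maps h X (C ∷ Y) → Maps h (P ∷ X) (C ∷ Q ∷ Y)
  maps-∷⁺ refl t (here refl) = there (here refl)
  maps-∷⁺ refl t (there m)   = ∷⁺ʳ _ (xs⊆x∷xs _ _) (t m)

  maps-snoc : ∀ {h P Q X Y} → substPFm h P ≡ Q → Maps h X Y → Maps h (X ++ [ P ]) (Q ∷ Y)
  maps-snoc {X = X} refl s m with ∈-++⁻ X m
  ... | inj₁ m₁ = there (s m₁)
  ... | inj₂ (here refl) = here refl

  maps-id : ∀ {X Y} → X ⊆ Y → Maps idSubst X Y
  maps-id {Y = Y} s {P} m = subst (_∈ Y) (sym (substPFm-id P)) (s m)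

  maps-update : ∀ {h α y z X Y} → ¬ InI (α ++ [ y ]) X → Maps h X Y → Maps (update h α y z) X Y
  maps-update {h} {α} {y} {z} {Y = Y} n s {P} m =
    subst (_∈ Y) (sym (cong (fm P ^_) (substPos-update h α y z (pos P) (λ p → n (lose m p))))) (s m)

  maps-freshˡ : ∀ {h γ z} Γ₁ Δ₁ {Γ} → Maps h Γ₁ Γ → Maps (update h γ (fresh (Γ₁ ++ Δ₁)) z) Γ₁ Γ
  maps-freshˡ {γ = γ} Γ₁ Δ₁ = maps-update (∉I-++ˡ Γ₁ Δ₁ (fresh-∉I γ (Γ₁ ++ Δ₁)))

  maps-freshʳ : ∀ {h γ z} Γ₁ Δ₁ {Δ} → Maps h Δ₁ Δ → Maps (update h γ (fresh (Γ₁ ++ Δ₁)) z) Δ₁ Δ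
  maps-freshʳ {γ = γ} Γ₁ Δ₁ = maps-update (∉I-++ʳ Γ₁ Δ₁ (fresh-∉I γ (Γ₁ ++ Δ₁)))

  AllPresent : Seq → Seq → Seq → Set
  AllPresent Ξ Γ Δ = ∀ {Q} → Q ∈ Ξ → Present M (pos Q) Γ Δ

  allPresentˡ : ∀ {Γ Δ} → AllPresent Γ Γ Δ
  allPresentˡ m = present λ _ → ∈⇒InI (∈-++⁺ˡ m)

  allPresentʳ : ∀ {Γ Δ} → AllPresent Δ Γ Δ
  allPresentʳ {Γ} m = present λ _ → ∈⇒InI (∈-++⁺ʳ Γ m)

  allPresent-∷ : ∀ {A α Ξ Γ Δ} → Present M α Γ Δ → AllPresent Ξ Γ Δ → AllPresent ((A ^ α) ∷ Ξ) Γ Δ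
  allPresent-∷ p a (here refl) = p
  allPresent-∷ p a (there m)   = a m

  PresentUnder : PosSubst → Seq → Seq → Seq → Seq → Set
  PresentUnder h Γ₁ Δ₁ Γ Δ = ∀ {P} → P ∈ Γ₁ ⊎ P ∈ Δ₁ → Present M (substPos h (pos P)) Γ Δ

  presentUnder : ∀ {h Γ₁ Δ₁ Γ′ Δ′ Γ Δ} → Maps h Γ₁ Γ′ → Maps h Δ₁ Δ′ →
                 AllPresent Γ′ Γ Δ → AllPresent Δ′ Γ Δ → PresentUnder h Γ₁ Δ₁ Γ Δ
  presentUnder s t a b (inj₁ m) = a (s m)
  presentUnder s t a b (inj₂ m) = b (t m)

  present-subst : ∀ {h π Γ₁ Δ₁ Γ Δ} → PresentUnder h Γ₁ Δ₁ Γ Δ →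
                  Present M π Γ₁ Δ₁ → Present M (substPos h π) Γ Δ
  present-subst {h} {Γ₁ = Γ₁} w p = present λ r →
    let P , m , π⪯P = find (inI p r) in InI-prefix (substPos-mono h π⪯P) (inI (w (∈-++⁻ Γ₁ m)) r)

  modCond-subst : ∀ {h α β Γ₁ Δ₁ Γ Δ} → Admissible M h → PresentUnder h Γ₁ Δ₁ Γ Δ →
                  ModCond M α β Γ₁ Δ₁ → ModCond M (substPos h α) (substAfter h α β) Γ Δ
  modCond-subst {h} {α} {β} {Γ = Γ} {Δ} adm w c =
    modCond-intro M (substAfter-shape M α β adm (modCond⇒shape M c))
      (subst (λ π → Present M π Γ Δ) (substPos-++ h α β)
             (present-subst w (modCond⇒present M c)))

  derSubst : ∀ {h Γ₁ Δ₁ Γ Δ} → Admissible M h → Der Γ₁ Δ₁ → Maps h Γ₁ Γ → Maps h Δ₁ Δ → Der Γ Δ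
  derSubst adm (ax m₁ m₂) s t = ax (s m₁) (t m₂)
  derSubst adm (¬L m d) s t = ¬L (s m) (derSubst adm d s (maps-∷ refl t))
  derSubst adm (¬R m d) s t = ¬R (t m) (derSubst adm d (maps-∷ refl s) t)
  derSubst adm (∧L₁ m d) s t = ∧L₁ (s m) (derSubst adm d (maps-∷ refl s) t)
  derSubst adm (∧L₂ m d) s t = ∧L₂ (s m) (derSubst adm d (maps-∷ refl s) t)
  derSubst adm (∧R m d e) s t = ∧R (t m) (derSubst adm d s (maps-∷ refl t)) (derSubst adm e s (maps-∷ refl t))
  derSubst adm (∨L m d e) s t = ∨L (s m) (derSubst adm d (maps-∷ refl s) t) (derSubst adm e (maps-∷ refl s) t)
  derSubst adm (∨R₁ m d) s t = ∨R₁ (t m) (derSubst adm d s (maps-∷ refl t))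
  derSubst adm (∨R₂ m d) s t = ∨R₂ (t m) (derSubst adm d s (maps-∷ refl t))
  derSubst adm (⇒L m d e) s t = ⇒L (s m) (derSubst adm d (maps-∷ refl s) t) (derSubst adm e s (maps-∷ refl t))
  derSubst adm (⇒R m d) s t = ⇒R (t m) (derSubst adm d (maps-∷ refl s) (maps-∷ refl t))
  derSubst {h} adm (□L {A = A} {α} {β} m c d) s t =
    □L (s m) (modCond-subst adm (presentUnder s t allPresentˡ allPresentʳ) c)
       (derSubst adm d (maps-∷ (substPFm-++ h α β A) s) t)
  derSubst {h} adm (◇R {A = A} {α} {β} m c d) s t =
    ◇R (t m) (modCond-subst adm (presentUnder s t allPresentˡ allPresentʳ) c)
       (derSubst adm d s (maps-∷ (substPFm-++ h α β A) t))
  derSubst {h} {Γ₁} {Δ₁} adm (□R {A = A} {α} m f) s t = □R (t m) λ z _ →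
    let y = fresh (Γ₁ ++ Δ₁) in
    derSubst (update-admissible M α y [ z ] (single M z) adm) (f y (fresh-∉I α (Γ₁ ++ Δ₁)))
      (maps-freshˡ Γ₁ Δ₁ s) (maps-∷ (substPFm-update-at h α y [ z ] A) (maps-freshʳ Γ₁ Δ₁ t))
  derSubst {h} {Γ₁} {Δ₁} adm (◇L {A = A} {α} m f) s t = ◇L (s m) λ z _ →
    let y = fresh (Γ₁ ++ Δ₁) in
    derSubst (update-admissible M α y [ z ] (single M z) adm) (f y (fresh-∉I α (Γ₁ ++ Δ₁)))
      (maps-∷ (substPFm-update-at h α y [ z ] A) (maps-freshˡ Γ₁ Δ₁ s)) (maps-freshʳ Γ₁ Δ₁ t)

  derWeaken : ∀ {Γ₁ Δ₁ Γ Δ} → Der Γ₁ Δ₁ → Γ₁ ⊆ Γ → Δ₁ ⊆ Δ → Der Γ Δ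
  derWeaken d s t = derSubst (idSubst-admissible M) d (maps-id s) (maps-id t)

  -- Cut admissibility

  -- RightIntro A α Γ Δ: what a right rule needs to introduce A^α into Γ ⊢ Δ.
  -- For □ the eigentoken is already instantiated by every M-shaped step; for
  -- ◇ the step comes with the parts of its side condition.  LeftIntro dually.
  RightIntro : Fm → Pos → Seq → Seq → Set
  RightIntro (var n) α Γ Δ = ⊥
  RightIntro (~ B)   α Γ Δ = Der ((B ^ α) ∷ Γ) Δ
  RightIntro (B ∧ C) α Γ Δ = Der Γ ((B ^ α) ∷ Δ) × Der Γ ((C ^ α) ∷ Δ)
  RightIntro (B ∨ C) α Γ Δ = Der Γ ((B ^ α) ∷ Δ) ⊎ Der Γ ((C ^ α) ∷ Δ)
  RightIntro (B ⇒ C) α Γ Δ = Der ((B ^ α) ∷ Γ) ((C ^ α) ∷ Δ)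
  RightIntro (□ B)   α Γ Δ = ∀ β → Shape M β → Der Γ ((B ^ (α ++ β)) ∷ Δ)
  RightIntro (◇ B)   α Γ Δ = Σ Pos λ β → Shape M β × Present M (α ++ β) Γ Δ × Der Γ ((B ^ (α ++ β)) ∷ Δ)

  LeftIntro : Fm → Pos → Seq → Seq → Set
  LeftIntro (var n) α Γ Δ = ⊥
  LeftIntro (~ B)   α Γ Δ = Der Γ ((B ^ α) ∷ Δ)
  LeftIntro (B ∧ C) α Γ Δ = Der ((B ^ α) ∷ Γ) Δ ⊎ Der ((C ^ α) ∷ Γ) Δ
  LeftIntro (B ∨ C) α Γ Δ = Der ((B ^ α) ∷ Γ) Δ × Der ((C ^ α) ∷ Γ) Δ
  LeftIntro (B ⇒ C) α Γ Δ = Der Γ ((B ^ α) ∷ Δ) × Der ((C ^ α) ∷ Γ) Δ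
  LeftIntro (□ B)   α Γ Δ = Σ Pos λ β → Shape M β × Present M (α ++ β) Γ Δ × Der ((B ^ (α ++ β)) ∷ Γ) Δ
  LeftIntro (◇ B)   α Γ Δ = ∀ β → Shape M β → Der ((B ^ (α ++ β)) ∷ Γ) Δ

  rightIntro-weaken : ∀ A {α Γ Δ Γ′ Δ′} → Γ ⊆ Γ′ → Δ ⊆ Δ′ → RightIntro A α Γ Δ → RightIntro A α Γ′ Δ′
  rightIntro-weaken (~ B)   s t r = derWeaken r (∷⁺ʳ _ s) t
  rightIntro-weaken (B ∧ C) s t (r₁ , r₂) = derWeaken r₁ s (∷⁺ʳ _ t) , derWeaken r₂ s (∷⁺ʳ _ t)
  rightIntro-weaken (B ∨ C) s t (inj₁ r) = inj₁ (derWeaken r s (∷⁺ʳ _ t))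
  rightIntro-weaken (B ∨ C) s t (inj₂ r) = inj₂ (derWeaken r s (∷⁺ʳ _ t))
  rightIntro-weaken (B ⇒ C) s t r = derWeaken r (∷⁺ʳ _ s) (∷⁺ʳ _ t)
  rightIntro-weaken (□ B)   s t r = λ β sh → derWeaken (r β sh) s (∷⁺ʳ _ t)
  rightIntro-weaken (◇ B)   s t (β , sh , p , r) = β , sh , present-mono s t p , derWeaken r s (∷⁺ʳ _ t)

  -- A cut on A^α can be closed once A^α is principal on one side, or occurs
  -- on the other side (the axiom case).
  RightClosable : Fm → Pos → Seq → Seq → Set
  RightClosable A α Γ Δ = RightIntro A α Γ Δ ⊎ (A ^ α) ∈ Γ

  LeftClosable : Fm → Pos → Seq → Seq → Set
  LeftClosable A α Γ Δ = LeftIntro A α Γ Δ ⊎ (A ^ α) ∈ Δ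

  Handler : (Seq → Seq → Set) → Seq → Seq → Set
  Handler C Γ₀ Δ₀ = ∀ {Γ Δ} → Γ₀ ⊆ Γ → Δ₀ ⊆ Δ → C Γ Δ → Der Γ Δ

  handler-∷ˡ : ∀ {C X Γ Δ} → Handler C Γ Δ → Handler C (X ∷ Γ) Δ
  handler-∷ˡ k s t = k (⊆-trans (xs⊆x∷xs _ _) s) t

  handler-∷ʳ : ∀ {C X Γ Δ} → Handler C Γ Δ → Handler C Γ (X ∷ Δ)
  handler-∷ʳ k s t = k s (⊆-trans (xs⊆x∷xs _ _) t)

  close : ∀ {C Γ Δ} → Handler C Γ Δ → C Γ Δ → Der Γ Δ
  close k = k ⊆-refl ⊆-refl

  present-∷ˡ : ∀ {π X Γ Δ} → Present M π Γ Δ → Present M π (X ∷ Γ) Δ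
  present-∷ˡ = present-mono (xs⊆x∷xs _ _) ⊆-refl

  present-∷ʳ : ∀ {π X Γ Δ} → Present M π Γ Δ → Present M π Γ (X ∷ Δ)
  present-∷ʳ = present-mono ⊆-refl (xs⊆x∷xs _ _)

  presentUnderˡ : ∀ {h Γ₁ Δ₁ Γ Δ A α} → Maps h Γ₁ Γ → Maps h Δ₁ ((A ^ α) ∷ Δ) →
                  Present M α Γ Δ → PresentUnder h Γ₁ Δ₁ Γ Δ
  presentUnderˡ s t pr = presentUnder s t allPresentˡ (allPresent-∷ pr allPresentʳ)

  presentUnderʳ : ∀ {h Γ₁ Δ₁ Γ Δ A α} → Maps h Γ₁ ((A ^ α) ∷ Γ) → Maps h Δ₁ Δ →
                  Present M α Γ Δ → PresentUnder h Γ₁ Δ₁ Γ Δ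
  presentUnderʳ s t pr = presentUnder s t (allPresent-∷ pr allPresentˡ) allPresentʳ

  -- Trace the cut formula A^α up the left premise (seen through h) until it
  -- is introduced on the right or met by an axiom, and hand over to k there.
  cutLeft : ∀ {A α h Γ₁ Δ₁ Γ Δ} → Admissible M h → Der Γ₁ Δ₁ →
            Maps h Γ₁ Γ → Maps h Δ₁ ((A ^ α) ∷ Δ) → Present M α Γ Δ →
            Handler (RightClosable A α) Γ Δ → Der Γ Δ
  cutLeft adm (ax m₁ m₂) s t pr k with t m₂
  ... | here eq = close k (inj₂ (subst (_∈ _) eq (s m₁)))
  ... | there m = ax (s m₁) m
  cutLeft adm (¬L m d) s t pr k = ¬L (s m) (cutLeft adm d s (maps-∷⁺ refl t) (present-∷ʳ pr) (handler-∷ʳ k))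
  cutLeft adm (∧L₁ m d) s t pr k = ∧L₁ (s m) (cutLeft adm d (maps-∷ refl s) t (present-∷ˡ pr) (handler-∷ˡ k))
  cutLeft adm (∧L₂ m d) s t pr k = ∧L₂ (s m) (cutLeft adm d (maps-∷ refl s) t (present-∷ˡ pr) (handler-∷ˡ k))
  cutLeft adm (∨L m d e) s t pr k =
    ∨L (s m) (cutLeft adm d (maps-∷ refl s) t (present-∷ˡ pr) (handler-∷ˡ k))
             (cutLeft adm e (maps-∷ refl s) t (present-∷ˡ pr) (handler-∷ˡ k))
  cutLeft adm (⇒L m d e) s t pr k =
    ⇒L (s m) (cutLeft adm d (maps-∷ refl s) t (present-∷ˡ pr) (handler-∷ˡ k))
             (cutLeft adm e s (maps-∷⁺ refl t) (present-∷ʳ pr) (handler-∷ʳ k))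
  cutLeft {h = h} adm (□L {A = B} {γ} {β} m c d) s t pr k =
    □L (s m) (modCond-subst adm (presentUnderˡ s t pr) c)
       (cutLeft adm d (maps-∷ (substPFm-++ h γ β B) s) t (present-∷ˡ pr) (handler-∷ˡ k))
  cutLeft {h = h} {Γ₁} {Δ₁} adm (◇L {A = B} {γ} m f) s t pr k = ◇L (s m) λ z _ →
    let y = fresh (Γ₁ ++ Δ₁) in
    cutLeft (update-admissible M γ y [ z ] (single M z) adm) (f y (fresh-∉I γ (Γ₁ ++ Δ₁)))
      (maps-∷ (substPFm-update-at h γ y [ z ] B) (maps-freshˡ Γ₁ Δ₁ s)) (maps-freshʳ Γ₁ Δ₁ t)
      (present-∷ˡ pr) (handler-∷ˡ k)
  cutLeft adm (¬R m d) s t pr k with t m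
  ... | there m′ = ¬R m′ (cutLeft adm d (maps-∷ refl s) t (present-∷ˡ pr) (handler-∷ˡ k))
  ... | here refl = close k (inj₁ (cutLeft adm d (maps-∷ refl s) t (present-∷ˡ pr) (handler-∷ˡ k)))
  cutLeft adm (∧R m d e) s t pr k with t m
  ... | there m′ = ∧R m′ (cutLeft adm d s (maps-∷⁺ refl t) (present-∷ʳ pr) (handler-∷ʳ k))
                         (cutLeft adm e s (maps-∷⁺ refl t) (present-∷ʳ pr) (handler-∷ʳ k))
  ... | here refl = close k (inj₁ (cutLeft adm d s (maps-∷⁺ refl t) (present-∷ʳ pr) (handler-∷ʳ k) ,
                                   cutLeft adm e s (maps-∷⁺ refl t) (present-∷ʳ pr) (handler-∷ʳ k)))
  cutLeft adm (∨R₁ m d) s t pr k with t m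
  ... | there m′ = ∨R₁ m′ (cutLeft adm d s (maps-∷⁺ refl t) (present-∷ʳ pr) (handler-∷ʳ k))
  ... | here refl = close k (inj₁ (inj₁ (cutLeft adm d s (maps-∷⁺ refl t) (present-∷ʳ pr) (handler-∷ʳ k))))
  cutLeft adm (∨R₂ m d) s t pr k with t m
  ... | there m′ = ∨R₂ m′ (cutLeft adm d s (maps-∷⁺ refl t) (present-∷ʳ pr) (handler-∷ʳ k))
  ... | here refl = close k (inj₁ (inj₂ (cutLeft adm d s (maps-∷⁺ refl t) (present-∷ʳ pr) (handler-∷ʳ k))))
  cutLeft adm (⇒R m d) s t pr k with t m
  ... | there m′ = ⇒R m′ (cutLeft adm d (maps-∷ refl s) (maps-∷⁺ refl t) (present-∷ʳ (present-∷ˡ pr))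
                                  (handler-∷ʳ (handler-∷ˡ k)))
  ... | here refl = close k (inj₁ (cutLeft adm d (maps-∷ refl s) (maps-∷⁺ refl t) (present-∷ʳ (present-∷ˡ pr))
                                          (handler-∷ʳ (handler-∷ˡ k))))
  cutLeft {h = h} adm (◇R {A = B} {γ} {β} m c d) s t pr k with t m
  ... | there m′ = ◇R m′ (modCond-subst adm (presentUnderˡ s t pr) c)
                     (cutLeft adm d s (maps-∷⁺ (substPFm-++ h γ β B) t) (present-∷ʳ pr) (handler-∷ʳ k))
  ... | here refl =
    let c′ = modCond-subst adm (presentUnderˡ s t pr) c in
    close k (inj₁ (substAfter h γ β , modCond⇒shape M c′ , modCond⇒present M c′ ,
                   cutLeft adm d s (maps-∷⁺ (substPFm-++ h γ β B) t) (present-∷ʳ pr) (handler-∷ʳ k)))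
  cutLeft {h = h} {Γ₁} {Δ₁} adm (□R {A = B} {γ} m f) s t pr k with t m
  ... | there m′ = □R m′ λ z _ →
    let y = fresh (Γ₁ ++ Δ₁) in
    cutLeft (update-admissible M γ y [ z ] (single M z) adm) (f y (fresh-∉I γ (Γ₁ ++ Δ₁)))
      (maps-freshˡ Γ₁ Δ₁ s) (maps-∷⁺ (substPFm-update-at h γ y [ z ] B) (maps-freshʳ Γ₁ Δ₁ t))
      (present-∷ʳ pr) (handler-∷ʳ k)
  ... | here refl = close k (inj₁ λ β sh →
    let y = fresh (Γ₁ ++ Δ₁) in
    cutLeft (update-admissible M γ y β sh adm) (f y (fresh-∉I γ (Γ₁ ++ Δ₁)))
      (maps-freshˡ Γ₁ Δ₁ s) (maps-∷⁺ (substPFm-update-at h γ y β B) (maps-freshʳ Γ₁ Δ₁ t))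
      (present-∷ʳ pr) (handler-∷ʳ k))

  -- Dually, trace A^α up the right premise until it is introduced on the left.
  cutRight : ∀ {A α h Γ₂ Δ₂ Γ Δ} → Admissible M h → Der Γ₂ Δ₂ →
             Maps h Γ₂ ((A ^ α) ∷ Γ) → Maps h Δ₂ Δ → Present M α Γ Δ →
             Handler (LeftClosable A α) Γ Δ → Der Γ Δ
  cutRight adm (ax m₁ m₂) s t pr k with s m₁
  ... | here eq = close k (inj₂ (subst (_∈ _) eq (t m₂)))
  ... | there m = ax m (t m₂)
  cutRight adm (¬R m d) s t pr k = ¬R (t m) (cutRight adm d (maps-∷⁺ refl s) t (present-∷ˡ pr) (handler-∷ˡ k))
  cutRight adm (∧R m d e) s t pr k =
    ∧R (t m) (cutRight adm d s (maps-∷ refl t) (present-∷ʳ pr) (handler-∷ʳ k))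
             (cutRight adm e s (maps-∷ refl t) (present-∷ʳ pr) (handler-∷ʳ k))
  cutRight adm (∨R₁ m d) s t pr k = ∨R₁ (t m) (cutRight adm d s (maps-∷ refl t) (present-∷ʳ pr) (handler-∷ʳ k))
  cutRight adm (∨R₂ m d) s t pr k = ∨R₂ (t m) (cutRight adm d s (maps-∷ refl t) (present-∷ʳ pr) (handler-∷ʳ k))
  cutRight adm (⇒R m d) s t pr k =
    ⇒R (t m) (cutRight adm d (maps-∷⁺ refl s) (maps-∷ refl t) (present-∷ʳ (present-∷ˡ pr))
                       (handler-∷ʳ (handler-∷ˡ k)))
  cutRight {h = h} adm (◇R {A = B} {γ} {β} m c d) s t pr k =
    ◇R (t m) (modCond-subst adm (presentUnderʳ s t pr) c)
       (cutRight adm d s (maps-∷ (substPFm-++ h γ β B) t) (present-∷ʳ pr) (handler-∷ʳ k))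
  cutRight {h = h} {Γ₂} {Δ₂} adm (□R {A = B} {γ} m f) s t pr k = □R (t m) λ z _ →
    let y = fresh (Γ₂ ++ Δ₂) in
    cutRight (update-admissible M γ y [ z ] (single M z) adm) (f y (fresh-∉I γ (Γ₂ ++ Δ₂)))
      (maps-freshˡ Γ₂ Δ₂ s) (maps-∷ (substPFm-update-at h γ y [ z ] B) (maps-freshʳ Γ₂ Δ₂ t))
      (present-∷ʳ pr) (handler-∷ʳ k)
  cutRight adm (¬L m d) s t pr k with s m
  ... | there m′ = ¬L m′ (cutRight adm d s (maps-∷ refl t) (present-∷ʳ pr) (handler-∷ʳ k))
  ... | here refl = close k (inj₁ (cutRight adm d s (maps-∷ refl t) (present-∷ʳ pr) (handler-∷ʳ k)))
  cutRight adm (∧L₁ m d) s t pr k with s m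
  ... | there m′ = ∧L₁ m′ (cutRight adm d (maps-∷⁺ refl s) t (present-∷ˡ pr) (handler-∷ˡ k))
  ... | here refl = close k (inj₁ (inj₁ (cutRight adm d (maps-∷⁺ refl s) t (present-∷ˡ pr) (handler-∷ˡ k))))
  cutRight adm (∧L₂ m d) s t pr k with s m
  ... | there m′ = ∧L₂ m′ (cutRight adm d (maps-∷⁺ refl s) t (present-∷ˡ pr) (handler-∷ˡ k))
  ... | here refl = close k (inj₁ (inj₂ (cutRight adm d (maps-∷⁺ refl s) t (present-∷ˡ pr) (handler-∷ˡ k))))
  cutRight adm (∨L m d e) s t pr k with s m
  ... | there m′ = ∨L m′ (cutRight adm d (maps-∷⁺ refl s) t (present-∷ˡ pr) (handler-∷ˡ k))
                         (cutRight adm e (maps-∷⁺ refl s) t (present-∷ˡ pr) (handler-∷ˡ k))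
  ... | here refl = close k (inj₁ (cutRight adm d (maps-∷⁺ refl s) t (present-∷ˡ pr) (handler-∷ˡ k) ,
                                   cutRight adm e (maps-∷⁺ refl s) t (present-∷ˡ pr) (handler-∷ˡ k)))
  cutRight adm (⇒L m d e) s t pr k with s m
  ... | there m′ = ⇒L m′ (cutRight adm d (maps-∷⁺ refl s) t (present-∷ˡ pr) (handler-∷ˡ k))
                         (cutRight adm e s (maps-∷ refl t) (present-∷ʳ pr) (handler-∷ʳ k))
  ... | here refl = close k (inj₁ (cutRight adm e s (maps-∷ refl t) (present-∷ʳ pr) (handler-∷ʳ k) ,
                                   cutRight adm d (maps-∷⁺ refl s) t (present-∷ˡ pr) (handler-∷ˡ k)))
  cutRight {h = h} adm (□L {A = B} {γ} {β} m c d) s t pr k with s m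
  ... | there m′ = □L m′ (modCond-subst adm (presentUnderʳ s t pr) c)
                     (cutRight adm d (maps-∷⁺ (substPFm-++ h γ β B) s) t (present-∷ˡ pr) (handler-∷ˡ k))
  ... | here refl =
    let c′ = modCond-subst adm (presentUnderʳ s t pr) c in
    close k (inj₁ (substAfter h γ β , modCond⇒shape M c′ , modCond⇒present M c′ ,
                   cutRight adm d (maps-∷⁺ (substPFm-++ h γ β B) s) t (present-∷ˡ pr) (handler-∷ˡ k)))
  cutRight {h = h} {Γ₂} {Δ₂} adm (◇L {A = B} {γ} m f) s t pr k with s m
  ... | there m′ = ◇L m′ λ z _ →
    let y = fresh (Γ₂ ++ Δ₂) in
    cutRight (update-admissible M γ y [ z ] (single M z) adm) (f y (fresh-∉I γ (Γ₂ ++ Δ₂)))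
      (maps-∷⁺ (substPFm-update-at h γ y [ z ] B) (maps-freshˡ Γ₂ Δ₂ s)) (maps-freshʳ Γ₂ Δ₂ t)
      (present-∷ˡ pr) (handler-∷ˡ k)
  ... | here refl = close k (inj₁ λ β sh →
    let y = fresh (Γ₂ ++ Δ₂) in
    cutRight (update-admissible M γ y β sh adm) (f y (fresh-∉I γ (Γ₂ ++ Δ₂)))
      (maps-∷⁺ (substPFm-update-at h γ y β B) (maps-freshˡ Γ₂ Δ₂ s)) (maps-freshʳ Γ₂ Δ₂ t)
      (present-∷ˡ pr) (handler-∷ˡ k))

  mutual
    -- The left premise is traced by cutLeft; where A^α is introduced on its
    -- right, the right premise is traced by cutRight, and where A^α is then
    -- introduced on the left as well the cut is principal.
    cutAdmissible : ∀ A {α Γ₁ Δ₁ Γ₂ Δ₂ Γ Δ} → Der Γ₁ Δ₁ → Der Γ₂ Δ₂ →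
                    Γ₁ ⊆ Γ → Δ₁ ⊆ ((A ^ α) ∷ Δ) → Γ₂ ⊆ ((A ^ α) ∷ Γ) → Δ₂ ⊆ Δ →
                    Present M α Γ Δ → Der Γ Δ
    cutAdmissible A {α} {Γ = Γ} {Δ} d₁ d₂ s₁ t₁ s₂ t₂ pr =
      cutLeft (idSubst-admissible M) d₁ (maps-id s₁) (maps-id t₁) pr onRight
      where
        onRight : Handler (RightClosable A α) Γ Δ
        onRight e₁ e₂ (inj₂ A∈Γ′) = derWeaken d₂ (⊆-trans s₂ (∈-∷⁺ʳ A∈Γ′ e₁)) (⊆-trans t₂ e₂)
        onRight {Γ′} {Δ′} e₁ e₂ (inj₁ r) =
          cutRight (idSubst-admissible M) d₂ (maps-id (⊆-trans s₂ (∷⁺ʳ _ e₁))) (maps-id (⊆-trans t₂ e₂))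
                   (present-mono e₁ e₂ pr) onLeft
          where
            onLeft : Handler (LeftClosable A α) Γ′ Δ′
            onLeft f₁ f₂ (inj₂ A∈Δ″) =
              derWeaken d₁ (⊆-trans s₁ (⊆-trans e₁ f₁)) (⊆-trans t₁ (∈-∷⁺ʳ A∈Δ″ (⊆-trans e₂ f₂)))
            onLeft f₁ f₂ (inj₁ l) =
              principalCut A (rightIntro-weaken A f₁ f₂ r) l (present-mono (⊆-trans e₁ f₁) (⊆-trans e₂ f₂) pr)

    -- A cut between a right and a left introduction of A^α reduces to cuts on
    -- the immediate subformulas of A.
    principalCut : ∀ A {α Γ Δ} → RightIntro A α Γ Δ → LeftIntro A α Γ Δ → Present M α Γ Δ → Der Γ Δ
    principalCut (var n) () l pr
    principalCut (~ B) r l pr = cutAdmissible B l r ⊆-refl ⊆-refl ⊆-refl ⊆-refl pr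
    principalCut (B ∧ C) (r₁ , r₂) (inj₁ l) pr = cutAdmissible B r₁ l ⊆-refl ⊆-refl ⊆-refl ⊆-refl pr
    principalCut (B ∧ C) (r₁ , r₂) (inj₂ l) pr = cutAdmissible C r₂ l ⊆-refl ⊆-refl ⊆-refl ⊆-refl pr
    principalCut (B ∨ C) (inj₁ r) (l₁ , l₂) pr = cutAdmissible B r l₁ ⊆-refl ⊆-refl ⊆-refl ⊆-refl pr
    principalCut (B ∨ C) (inj₂ r) (l₁ , l₂) pr = cutAdmissible C r l₂ ⊆-refl ⊆-refl ⊆-refl ⊆-refl pr
    principalCut (B ⇒ C) r (l₁ , l₂) pr =
      cutAdmissible C (cutAdmissible B l₁ r ⊆-refl (∷⁺ʳ _ (xs⊆x∷xs _ _)) ⊆-refl ⊆-refl (present-∷ʳ pr)) l₂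
                    ⊆-refl ⊆-refl ⊆-refl ⊆-refl pr
    principalCut (□ B) r (β , sh , p , l) pr = cutAdmissible B (r β sh) l ⊆-refl ⊆-refl ⊆-refl ⊆-refl p
    principalCut (◇ B) (β , sh , p , r) l pr = cutAdmissible B r (l β sh) ⊆-refl ⊆-refl ⊆-refl ⊆-refl p

  -- Cut-free 2_M proofs and the structural rules

  CutFreeProof : Seq → Seq → Set
  CutFreeProof Γ Δ = Σ (Proof M Γ Δ) CutFree

  permuteˡ : ∀ Θ {Γ Γ′ Δ} → CutFreeProof (Θ ++ Γ) Δ → Γ ↭ Γ′ → CutFreeProof (Θ ++ Γ′) Δ
  permuteˡ Θ c ↭.refl = c
  permuteˡ Θ {x ∷ Γ} {x ∷ Γ′} c (↭.prep x p)
    rewrite sym (++-assoc Θ [ x ] Γ′) | sym (++-assoc Θ [ x ] Γ) = permuteˡ (Θ ++ [ x ]) c p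
  permuteˡ Θ {x ∷ y ∷ Γ} {y ∷ x ∷ Γ′} {Δ} (q , cf) (↭.swap x y p)
    rewrite sym (++-assoc Θ (y ∷ x ∷ []) Γ′) = permuteˡ (Θ ++ y ∷ x ∷ []) swapped p
    where
      swapped : CutFreeProof ((Θ ++ y ∷ x ∷ []) ++ Γ) Δ
      swapped rewrite ++-assoc Θ (y ∷ x ∷ []) Γ = eL {Γ₁ = Θ} q , cf
  permuteˡ Θ c (↭.trans p q) = permuteˡ Θ (permuteˡ Θ c p) q

  permuteʳ : ∀ Θ {Γ Δ Δ′} → CutFreeProof Γ (Θ ++ Δ) → Δ ↭ Δ′ → CutFreeProof Γ (Θ ++ Δ′)
  permuteʳ Θ c ↭.refl = c
  permuteʳ Θ {Δ = x ∷ Δ} {x ∷ Δ′} c (↭.prep x p)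
    rewrite sym (++-assoc Θ [ x ] Δ′) | sym (++-assoc Θ [ x ] Δ) = permuteʳ (Θ ++ [ x ]) c p
  permuteʳ Θ {Γ} {x ∷ y ∷ Δ} {y ∷ x ∷ Δ′} (q , cf) (↭.swap x y p)
    rewrite sym (++-assoc Θ (y ∷ x ∷ []) Δ′) = permuteʳ (Θ ++ y ∷ x ∷ []) swapped p
    where
      swapped : CutFreeProof Γ ((Θ ++ y ∷ x ∷ []) ++ Δ)
      swapped rewrite ++-assoc Θ (y ∷ x ∷ []) Δ = eR {Δ₁ = Θ} q , cf
  permuteʳ Θ c (↭.trans p q) = permuteʳ Θ (permuteʳ Θ c p) q

  absorbˡ : ∀ {x Ξ Δ} → CutFreeProof (x ∷ Ξ) Δ → x ∈ Ξ → CutFreeProof Ξ Δ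
  absorbˡ {x} c m with ∈-∃++ m
  ... | ys , zs , refl =
    let q , cf = permuteˡ [] c (↭.trans (↭.prep x (shift x ys zs)) (++-comm (x ∷ x ∷ []) (ys ++ zs)))
    in permuteˡ [] (cL {Γ = ys ++ zs} q , cf) (↭.trans (++-comm (ys ++ zs) [ x ]) (↭.↭-sym (shift x ys zs)))

  absorbʳ : ∀ {x Ξ Γ} → CutFreeProof Γ (x ∷ Ξ) → x ∈ Ξ → CutFreeProof Γ Ξ
  absorbʳ {x} c m with ∈-∃++ m
  ... | ys , zs , refl =
    let q , cf = permuteʳ [] c (↭.prep x (shift x ys zs))
    in permuteʳ [] (cR q , cf) (↭.↭-sym (shift x ys zs))

  weakenˡ* : ∀ {Γ Δ} Ξ → CutFreeProof Γ Δ → CutFreeProof (Γ ++ Ξ) Δ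
  weakenˡ* {Γ} [] c rewrite ++-identityʳ Γ = c
  weakenˡ* {Γ} (x ∷ Ξ) (q , cf) rewrite sym (++-assoc Γ [ x ] Ξ) = weakenˡ* Ξ (wL q , cf)

  weakenʳ* : ∀ {Γ Δ} Ξ → CutFreeProof Γ Δ → CutFreeProof Γ (Ξ ++ Δ)
  weakenʳ* [] c = c
  weakenʳ* (x ∷ Ξ) c = let q , cf = weakenʳ* Ξ c in wR q , cf

  absorbAllˡ : ∀ Γ {Γ′ Δ} → CutFreeProof (Γ ++ Γ′) Δ → Γ ⊆ Γ′ → CutFreeProof Γ′ Δ
  absorbAllˡ [] c s = c
  absorbAllˡ (x ∷ Γ) c s = absorbAllˡ Γ (absorbˡ c (∈-++⁺ʳ Γ (s (here refl)))) (⊆-trans (xs⊆x∷xs _ _) s)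

  absorbAllʳ : ∀ Δ {Δ′ Γ} → CutFreeProof Γ (Δ ++ Δ′) → Δ ⊆ Δ′ → CutFreeProof Γ Δ′
  absorbAllʳ [] c s = c
  absorbAllʳ (x ∷ Δ) c s = absorbAllʳ Δ (absorbʳ c (∈-++⁺ʳ Δ (s (here refl)))) (⊆-trans (xs⊆x∷xs _ _) s)

  cutFree-⊆ : ∀ {Γ Δ Γ′ Δ′} → CutFreeProof Γ Δ → Γ ⊆ Γ′ → Δ ⊆ Δ′ → CutFreeProof Γ′ Δ′
  cutFree-⊆ {Γ} {Δ} {Γ′} {Δ′} c s t =
    absorbAllʳ Δ (permuteʳ [] (weakenʳ* Δ′ (absorbAllˡ Γ (weakenˡ* Γ′ c) s)) (++-comm Δ′ Δ)) t

  -- From Der M back to cut-free 2_M: each Der rule is the corresponding 2_M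
  -- rule followed by structural rules (cutFree-⊆) moving the principal
  -- p-formula into place and merging the contexts of two-premise rules.
  derToCutFree : ∀ {Γ Δ} → Der Γ Δ → CutFreeProof Γ Δ
  derToCutFree (ax m₁ m₂) = cutFree-⊆ (ax , tt) (∈-∷⁺ʳ m₁ (λ ())) (∈-∷⁺ʳ m₂ (λ ()))
  derToCutFree (¬L m d) =
    let p , c = derToCutFree d in cutFree-⊆ (¬L p , c) (snoc⊆ m) ⊆-refl
  derToCutFree (¬R m d) =
    let p , c = cutFree-⊆ (derToCutFree d) ∷⊆snoc ⊆-refl in cutFree-⊆ (¬R p , c) ⊆-refl (∈-∷⁺ʳ m ⊆-refl)
  derToCutFree (∧L₁ m d) =
    let p , c = cutFree-⊆ (derToCutFree d) ∷⊆snoc ⊆-refl in cutFree-⊆ (∧L₁ p , c) (snoc⊆ m) ⊆-refl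
  derToCutFree (∧L₂ m d) =
    let p , c = cutFree-⊆ (derToCutFree d) ∷⊆snoc ⊆-refl in cutFree-⊆ (∧L₂ p , c) (snoc⊆ m) ⊆-refl
  derToCutFree (∧R m d e) =
    let p , c = derToCutFree d ; q , c′ = derToCutFree e in
    cutFree-⊆ (∧R p q , c , c′) ++-idem (∈-∷⁺ʳ m ++-idem)
  derToCutFree (∨L m d e) =
    let p , c = cutFree-⊆ (derToCutFree d) ∷⊆snoc ⊆-refl ; q , c′ = cutFree-⊆ (derToCutFree e) ∷⊆snoc ⊆-refl in
    cutFree-⊆ (∨L p q , c , c′) (⊆-trans (snoc⊆ (∈-++⁺ˡ m)) ++-idem) ++-idem
  derToCutFree (∨R₁ m d) =
    let p , c = derToCutFree d in cutFree-⊆ (∨R₁ p , c) ⊆-refl (∈-∷⁺ʳ m ⊆-refl)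
  derToCutFree (∨R₂ m d) =
    let p , c = derToCutFree d in cutFree-⊆ (∨R₂ p , c) ⊆-refl (∈-∷⁺ʳ m ⊆-refl)
  derToCutFree (⇒L m d e) =
    let p , c = cutFree-⊆ (derToCutFree d) ∷⊆snoc ⊆-refl ; q , c′ = derToCutFree e in
    cutFree-⊆ (⇒L p q , c , c′) (⊆-trans (snoc⊆ (∈-++⁺ˡ m)) ++-idem) ++-idem
  derToCutFree (⇒R m d) =
    let p , c = cutFree-⊆ (derToCutFree d) ∷⊆snoc ⊆-refl in cutFree-⊆ (⇒R p , c) ⊆-refl (∈-∷⁺ʳ m ⊆-refl)
  derToCutFree (□L m mc d) =
    let p , c = cutFree-⊆ (derToCutFree d) ∷⊆snoc ⊆-refl in cutFree-⊆ (□L mc p , c) (snoc⊆ m) ⊆-refl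
  derToCutFree (◇R m mc d) =
    let p , c = derToCutFree d in cutFree-⊆ (◇R mc p , c) ⊆-refl (∈-∷⁺ʳ m ⊆-refl)
  derToCutFree {Γ} {Δ} (□R {α = α} m f) =
    let p , c = derToCutFree (f (fresh (Γ ++ Δ)) (fresh-∉I α (Γ ++ Δ))) in
    cutFree-⊆ (□R (fresh-∉I α (Γ ++ Δ)) p , c) ⊆-refl (∈-∷⁺ʳ m ⊆-refl)
  derToCutFree {Γ} {Δ} (◇L {α = α} m f) =
    let p , c = cutFree-⊆ (derToCutFree (f (fresh (Γ ++ Δ)) (fresh-∉I α (Γ ++ Δ)))) ∷⊆snoc ⊆-refl in
    cutFree-⊆ (◇L (fresh-∉I α (Γ ++ Δ)) p , c) (snoc⊆ m) ⊆-refl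

  -- From 2_M to Der M: Cut becomes an instance of cut admissibility, the
  -- structural rules become inclusions, and the eigentoken x of a (⊢□) or
  -- (◇⊢) step is renamed into each fresh token z.
  proofToDer : ∀ {Γ Δ} → Proof M Γ Δ → Der Γ Δ
  proofToDer ax = ax (here refl) (here refl)
  proofToDer (cut {Γ₁} {Δ₁} {Γ₂} {Δ₂} {A} c p q) =
    cutAdmissible A (proofToDer p) (proofToDer q)
      (xs⊆xs++ys Γ₁ Γ₂) (∷⁺ʳ _ (xs⊆xs++ys Δ₁ Δ₂)) (snoc⊆∷ (xs⊆ys++xs Γ₂ Γ₁)) (xs⊆ys++xs Δ₂ Δ₁)
      (cutCond⇒present M c)
  proofToDer (wL p) = derWeaken (proofToDer p) (xs⊆xs++ys _ _) ⊆-refl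
  proofToDer (wR p) = derWeaken (proofToDer p) ⊆-refl (xs⊆x∷xs _ _)
  proofToDer (cL {Γ} p) = derWeaken (proofToDer p) (++⁺ʳ Γ (∈-∷⁺ʳ (here refl) ⊆-refl)) ⊆-refl
  proofToDer (cR p) = derWeaken (proofToDer p) ⊆-refl (∈-∷⁺ʳ (here refl) ⊆-refl)
  proofToDer (eL {Γ₁} p) = derWeaken (proofToDer p) (++⁺ʳ Γ₁ swap⊆) ⊆-refl
  proofToDer (eR {Δ₁ = Δ₁} p) = derWeaken (proofToDer p) ⊆-refl (++⁺ʳ Δ₁ swap⊆)
  proofToDer (¬L {Γ} p) = ¬L (∈-++⁺ʳ Γ (here refl)) (derWeaken (proofToDer p) (xs⊆xs++ys _ _) ⊆-refl)
  proofToDer (¬R p) = ¬R (here refl) (derWeaken (proofToDer p) (snoc⊆∷ ⊆-refl) (xs⊆x∷xs _ _))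
  proofToDer (∧L₁ {Γ} p) =
    ∧L₁ (∈-++⁺ʳ Γ (here refl)) (derWeaken (proofToDer p) (snoc⊆∷ (xs⊆xs++ys _ _)) ⊆-refl)
  proofToDer (∧L₂ {Γ} p) =
    ∧L₂ (∈-++⁺ʳ Γ (here refl)) (derWeaken (proofToDer p) (snoc⊆∷ (xs⊆xs++ys _ _)) ⊆-refl)
  proofToDer (∧R {Γ₁} {Γ₂} {Δ₁} {Δ₂} p q) =
    ∧R (here refl) (derWeaken (proofToDer p) (xs⊆xs++ys Γ₁ Γ₂) (∷⁺ʳ _ (⊆-trans (xs⊆xs++ys Δ₁ Δ₂) (xs⊆x∷xs _ _))))
                   (derWeaken (proofToDer q) (xs⊆ys++xs Γ₂ Γ₁) (∷⁺ʳ _ (⊆-trans (xs⊆ys++xs Δ₂ Δ₁) (xs⊆x∷xs _ _))))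
  proofToDer (∨L {Γ₁} {Γ₂} {Δ₁} {Δ₂} p q) =
    ∨L (∈-++⁺ʳ (Γ₁ ++ Γ₂) (here refl))
       (derWeaken (proofToDer p) (snoc⊆∷ (⊆-trans (xs⊆xs++ys Γ₁ Γ₂) (xs⊆xs++ys _ _))) (xs⊆xs++ys Δ₁ Δ₂))
       (derWeaken (proofToDer q) (snoc⊆∷ (⊆-trans (xs⊆ys++xs Γ₂ Γ₁) (xs⊆xs++ys _ _))) (xs⊆ys++xs Δ₂ Δ₁))
  proofToDer (∨R₁ p) = ∨R₁ (here refl) (derWeaken (proofToDer p) ⊆-refl (∷⁺ʳ _ (xs⊆x∷xs _ _)))
  proofToDer (∨R₂ p) = ∨R₂ (here refl) (derWeaken (proofToDer p) ⊆-refl (∷⁺ʳ _ (xs⊆x∷xs _ _)))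
  proofToDer (⇒L {Γ₁} {Γ₂} {Δ₁} {Δ₂} p q) =
    ⇒L (∈-++⁺ʳ (Γ₁ ++ Γ₂) (here refl))
       (derWeaken (proofToDer p) (snoc⊆∷ (⊆-trans (xs⊆xs++ys Γ₁ Γ₂) (xs⊆xs++ys _ _))) (xs⊆xs++ys Δ₁ Δ₂))
       (derWeaken (proofToDer q) (⊆-trans (xs⊆ys++xs Γ₂ Γ₁) (xs⊆xs++ys _ _)) (∷⁺ʳ _ (xs⊆ys++xs Δ₂ Δ₁)))
  proofToDer (⇒R p) = ⇒R (here refl) (derWeaken (proofToDer p) (snoc⊆∷ ⊆-refl) (∷⁺ʳ _ (xs⊆x∷xs _ _)))
  proofToDer (□L {Γ} c p) =
    □L (∈-++⁺ʳ Γ (here refl)) (modCond-mono M (xs⊆xs++ys _ _) ⊆-refl c)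
       (derWeaken (proofToDer p) (snoc⊆∷ (xs⊆xs++ys _ _)) ⊆-refl)
  proofToDer (◇R c p) =
    ◇R (here refl) (modCond-mono M ⊆-refl (xs⊆x∷xs _ _) c) (derWeaken (proofToDer p) ⊆-refl (∷⁺ʳ _ (xs⊆x∷xs _ _)))
  proofToDer (□R {Γ} {Δ} {A} {α} {x} fr p) = □R (here refl) λ z _ →
    derSubst (update-admissible M α x [ z ] (single M z) (idSubst-admissible M)) (proofToDer p)
      (maps-update (∉I-++ˡ Γ Δ fr) (maps-id ⊆-refl))
      (maps-∷ (rename-eigentoken α x [ z ] A) (maps-update (∉I-++ʳ Γ Δ fr) (maps-id (xs⊆x∷xs _ _))))
  proofToDer (◇L {Γ} {Δ} {A} {α} {x} fr p) = ◇L (∈-++⁺ʳ Γ (here refl)) λ z _ →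
    derSubst (update-admissible M α x [ z ] (single M z) (idSubst-admissible M)) (proofToDer p)
      (maps-snoc (rename-eigentoken α x [ z ] A) (maps-update (∉I-++ˡ Γ Δ fr) (maps-id (xs⊆xs++ys _ _))))
      (maps-update (∉I-++ʳ Γ Δ fr) (maps-id ⊆-refl))


mainTheorem1 : (M : Logic) (Γ Δ : Seq) → Proof M Γ Δ →
    Σ (Proof M Γ Δ) (λ Π* → CutFree Π*)
mainTheorem1 M Γ Δ Π = derToCutFree (proofToDer Π)
  where open Calculus M
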